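{- Let $S_{nk}$ denote the Stirling number of the second kind (the number of partitions of an $n$-element set into $k$ blocks). For all $n\ge 0$, $$S_{nn}\le S_{n(n-1)}\le\cdots\le S_{n\lfloor (n+1)/2\rfloor},$$ and for every integer $k$ with $0\le k\le n/2$, $$S_{nk}\ge S_{n(n+1-k)}.$$ -}

module Defs where

open import Data.Nat using (ℕ; zero; suc; _+_; _*_)

S : ℕ → ℕ → ℕ
S zero    zero    = 1
S zero    (suc k) = 0
S (suc n) zero    = 0
S (suc n) (suc k) = suc k * S n (suc k) + S n k

{-# OPTIONS --safe #-}
-- The key estimate is  k (3 S(n,k+1) + S(n,k)) ≤ n (S(n,k+1) + S(n,k)),  i.e.
-- (3k - n) S(n,k+1) ≤ (n - k) S(n,k), valid for all n and k. It goes by induction on n: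
-- once S(n+1,-) is expanded by the recurrence, the estimate at (n+1,k+1) is a nonnegative
-- combination of the estimates at (n,k+1) and (n,k).
-- For n ≤ 2k it forces S(n,k+1) ≤ S(n,k). For n = j + k with k ≤ j, a second induction
-- compares S(n,j+1) = (j+1) S(n-1,j+1) + S(n-1,j) with S(n,k) = k S(n-1,k) + S(n-1,k-1):
-- S(n-1,j) ≤ S(n-1,k) is the induction hypothesis, and the estimate at (n-1,j) gives
-- (j+1) S(n-1,j+1) ≤ (k-1) S(n-1,j).
module Submission where

open import Defs
open import Data.Nat using (ℕ; zero; suc; _+_; _*_; _∸_; _≤_; _<_; _/_; _%_; z≤n; s≤s)
open import Data.Nat.Properties
open import Data.Nat.DivMod using (m≡m%n+[m/n]*n; m%n<n)
open import Data.Nat.Tactic.RingSolver using (solve)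
open import Data.List using ([]; _∷_)
open import Data.Product using (_×_; _,_)
open import Data.Sum using (inj₁; inj₂)
open import Relation.Binary.PropositionalEquality using (_≡_; refl; sym; cong; subst; subst₂)

S-vanishes : ∀ {n k} → n < k → S n k ≡ 0
S-vanishes {zero}  {suc k} _         = refl
S-vanishes {suc n} {suc k} (s≤s n<k)
  rewrite S-vanishes (m<n⇒m<1+n n<k) | S-vanishes n<k | *-zeroʳ k = refl

≤-by-certificate : ∀ {l r p q} u → q ≤ p → l + p + u ≡ r + q → l ≤ r
≤-by-certificate {l} {r} {p} {q} u q≤p l+p+u≡r+q = +-cancelʳ-≤ q l r (begin
  l + q      ≤⟨ +-monoʳ-≤ l q≤p ⟩
  l + p      ≤⟨ m≤m+n (l + p) u ⟩
  l + p + u  ≡⟨ l+p+u≡r+q ⟩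
  r + q      ∎)
  where open ≤-Reasoning

-- The hypotheses enter with weights k + 2 and 1 when n ≤ 2k, and k + 1 and 0 otherwise.
ratio-bound-step : ∀ n k x y z →
  suc k * (3 * x + y) ≤ n * (x + y) →
  k * (3 * y + z) ≤ n * (y + z) →
  suc k * (3 * (suc (suc k) * x + y) + (suc k * y + z))
    ≤ suc n * (suc (suc k) * x + y + (suc k * y + z))
ratio-bound-step n k x y z bound[1+k] bound[k] with ≤-<-connex n (k + k)
... | inj₁ n≤k+k = ≤-by-certificate (suc (suc k) * x)
        (+-mono-≤ (+-mono-≤ (*-mono-≤ (≤-refl {suc (suc k)}) bound[1+k]) bound[k])
                  (*-mono-≤ n≤k+k (≤-refl {y})))
        (solve (n ∷ k ∷ x ∷ y ∷ z ∷ []))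
... | inj₂ k+k<n with m , refl ← m≤n⇒∃[o]m+o≡n k+k<n =
        ≤-by-certificate (m * (x + y) + (suc k + m) * z)
          (*-mono-≤ (≤-refl {suc k}) bound[1+k])
          (solve (k ∷ m ∷ x ∷ y ∷ z ∷ []))

S-ratio-bound : ∀ n k → k * (3 * S n (suc k) + S n k) ≤ n * (S n (suc k) + S n k)
S-ratio-bound zero    zero    = z≤n
S-ratio-bound zero    (suc k) = ≤-reflexive (*-zeroʳ (suc k))
S-ratio-bound (suc n) zero    = z≤n
S-ratio-bound (suc n) (suc k) =
  ratio-bound-step n k (S n (suc (suc k))) (S n (suc k)) (S n k)
    (S-ratio-bound n (suc k)) (S-ratio-bound n k)

S-ratio-bound′ : ∀ {n k i} → n ≤ k + i → (k + k) * S n (suc k) ≤ i * (S n (suc k) + S n k)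
S-ratio-bound′ {n} {k} {i} n≤k+i with S n (suc k) | S n k | S-ratio-bound n k
... | a | b | bound = ≤-by-certificate 0
        (≤-trans bound (*-mono-≤ n≤k+i (≤-refl {a + b})))
        (solve (k ∷ i ∷ a ∷ b ∷ []))

S-nonincreasing-above-half : ∀ n k → n ≤ k + k → S n (suc k) ≤ S n k
S-nonincreasing-above-half n zero    z≤n   = z≤n
S-nonincreasing-above-half n (suc k) n≤k+k =
  *-cancelˡ-≤ (suc k) (+-cancelˡ-≤ (suc k * a) (suc k * a) (suc k * b) (begin
    suc k * a + suc k * a  ≡⟨ sym (*-distribʳ-+ a (suc k) (suc k)) ⟩
    (suc k + suc k) * a    ≤⟨ S-ratio-bound′ n≤k+k ⟩
    suc k * (a + b)        ≡⟨ *-distribˡ-+ (suc k) a b ⟩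
    suc k * a + suc k * b  ∎))
  where
  open ≤-Reasoning
  a b : ℕ
  a = S n (suc (suc k))
  b = S n (suc k)

S-ratio-bound-strict : ∀ {n k i} → n ≤ k + i → i < k → suc k * S n (suc k) ≤ i * S n k
S-ratio-bound-strict {n} {k} {i} n≤k+i i<k = +-cancelʳ-≤ (i * a) (suc k * a) (i * b) (begin
    suc k * a + i * a  ≡⟨ sym (*-distribʳ-+ a (suc k) i) ⟩
    (suc k + i) * a    ≤⟨ *-monoˡ-≤ a 1+k+i≤k+k ⟩
    (k + k) * a        ≤⟨ S-ratio-bound′ {k = k} n≤k+i ⟩
    i * (a + b)        ≡⟨ *-distribˡ-+ i a b ⟩
    i * a + i * b      ≡⟨ +-comm (i * a) (i * b) ⟩
    i * b + i * a      ∎)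
  where
  open ≤-Reasoning
  a b : ℕ
  a = S n (suc k)
  b = S n k
  1+k+i≤k+k : suc k + i ≤ k + k
  1+k+i≤k+k = subst (_≤ k + k) (+-suc k i) (+-monoʳ-≤ k i<k)

-- With n = j + k this reads S(n, n + 1 - k) ≤ S(n, k).
S-mirror : ∀ j k → k ≤ suc j → S (j + k) (suc j) ≤ S (j + k) k
S-mirror j       zero    _ = ≤-trans (≤-reflexive (S-vanishes (s≤s (≤-reflexive (+-identityʳ j))))) z≤n
S-mirror zero    (suc k) (s≤s z≤n) = ≤-refl
S-mirror (suc j) (suc k) (s≤s k≤1+j) with m≤n⇒m<n∨m≡n k≤1+j
... | inj₂ refl      = ≤-refl
... | inj₁ (s≤s k≤j) = begin
    suc (suc j) * X + Y  ≤⟨ +-monoˡ-≤ Y (S-ratio-bound-strict (≤-reflexive (+-suc j k)) (s≤s k≤j)) ⟩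
    k * Y + Y            ≤⟨ +-mono-≤ (*-monoʳ-≤ k Y≤Z) Y≤Z ⟩
    k * Z + Z            ≡⟨ +-comm (k * Z) Z ⟩
    suc k * Z            ≤⟨ m≤m+n (suc k * Z) W ⟩
    suc k * Z + W        ∎
  where
  open ≤-Reasoning
  m X Y Z W : ℕ
  m = j + suc k
  X = S m (suc (suc j))
  Y = S m (suc j)
  Z = S m (suc k)
  W = S m k
  Y≤Z : Y ≤ Z
  Y≤Z = S-mirror j (suc k) (s≤s k≤j)

S-mirror-lower-half : ∀ n k → 2 * k ≤ n → S n (suc n ∸ k) ≤ S n k
S-mirror-lower-half n k 2k≤n =
  subst₂ (λ m i → S m i ≤ S m k) (m∸n+n≡m k≤n) (sym (+-∸-assoc 1 k≤n))
    (S-mirror (n ∸ k) k (m≤n⇒m≤1+n (m+n≤o⇒m≤o∸n k k+k≤n)))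
  where
  k+k≤n : k + k ≤ n
  k+k≤n = subst (_≤ n) (cong (k +_) (+-identityʳ k)) 2k≤n
  k≤n : k ≤ n
  k≤n = m+n≤o⇒m≤o k k+k≤n

[1+n]/2≤k⇒n≤k+k : ∀ n {k} → suc n / 2 ≤ k → n ≤ k + k
[1+n]/2≤k⇒n≤k+k n {k} [1+n]/2≤k = ≤-pred (begin
  suc n                        ≡⟨ m≡m%n+[m/n]*n (suc n) 2 ⟩
  suc n % 2 + suc n / 2 * 2    ≤⟨ +-mono-≤ (≤-pred (m%n<n (suc n) 2)) (*-monoˡ-≤ 2 [1+n]/2≤k) ⟩
  1 + k * 2                    ≡⟨ solve (k ∷ []) ⟩
  suc (k + k)                  ∎)
  where open ≤-Reasoning

corollary2 : ∀ (n : ℕ)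
    → (∀ (k : ℕ) → (suc n) / 2 ≤ k → k < n → S n (suc k) ≤ S n k)
    × (∀ (k : ℕ) → 2 * k ≤ n → S n (suc n ∸ k) ≤ S n k)
corollary2 n =
    (λ k [1+n]/2≤k _ → S-nonincreasing-above-half n k ([1+n]/2≤k⇒n≤k+k n [1+n]/2≤k))
  , S-mirror-lower-half n
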